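{- Let $r>0$ be an even integer and $\ell\geqslant 0$, and let $\mathsf{d}_{r,\ell}=(1-q^rz)(1-q^{r+2}z)\cdots(1-q^{r+2\ell}z)$. Then there exist non-zero polynomials $p_{r,\ell,i}\in\mathbb{Z}[z,q]$, $0\leqslant i\leqslant\ell$, such that \[ \sum_{i=0}^{\ell}p_{r,\ell,i}\frac{\mathsf{d}_{r,\ell}}{1-q^{r+2i}z}=(1-z)(1-z^2)\cdots(1-z^{\ell}). \] -}

module Defs where

open import Data.Nat using (ℕ; zero; suc; _+_; _*_)
open import Data.Nat.Properties using (_≟_)
open import Data.Integer as ℤ using (ℤ; +_; -[1+_])
open import Data.List using (List; []; _∷_; map; replicate; _++_; foldr; upTo)
open import Data.Fin using (Fin; toℕ)
open import Data.Bool using (if_then_else_)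
open import Relation.Nullary.Decidable using (⌊_⌋)
open import Relation.Binary.PropositionalEquality using (_≡_)
open import Relation.Nullary using (¬_)

-- Dense coefficient lists (lowest degree first) over a commutative carrier.
module ListPoly {A : Set} (0# : A) (_⊕_ _⊗_ : A → A → A) where
  addP : List A → List A → List A
  addP [] ys = ys
  addP xs [] = xs
  addP (x ∷ xs) (y ∷ ys) = (x ⊕ y) ∷ addP xs ys

  scaleP : A → List A → List A
  scaleP a = map (a ⊗_)

  mulP : List A → List A → List A
  mulP [] ys = []
  mulP (x ∷ xs) ys = addP (scaleP x ys) (0# ∷ mulP xs ys)

  coeff : List A → ℕ → A
  coeff [] _ = 0#
  coeff (x ∷ xs) zero = x
  coeff (x ∷ xs) (suc n) = coeff xs n

ZPoly : Set
ZPoly = List ℤ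

module Z1 = ListPoly (+ 0) ℤ._+_ ℤ._*_

-- ℤ[z,q] = (ℤ[q])[z]: the j-th entry is the coefficient of z^j, a polynomial in q.
Poly : Set
Poly = List ZPoly

module Z2 = ListPoly [] Z1.addP Z1.mulP

_+P_ : Poly → Poly → Poly
_+P_ = Z2.addP

_*P_ : Poly → Poly → Poly
_*P_ = Z2.mulP

coeff2 : Poly → ℕ → ℕ → ℤ
coeff2 p j k = Z1.coeff (Z2.coeff p j) k

-- equality of polynomials (coefficientwise; lists may carry trailing zeros)
_≈P_ : Poly → Poly → Set
p ≈P p' = ∀ j k → coeff2 p j k ≡ coeff2 p' j k

NonZeroP : Poly → Set
NonZeroP p = ¬ (∀ j k → coeff2 p j k ≡ + 0)

zeroP : Poly
zeroP = []

oneP : Poly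
oneP = (+ 1 ∷ []) ∷ []

qPow : ℕ → ZPoly
qPow m = replicate m (+ 0) ++ (+ 1 ∷ [])

-- 1 - q^m z
factor : ℕ → Poly
factor m = (+ 1 ∷ []) ∷ (replicate m (+ 0) ++ (-[1+ 0 ] ∷ [])) ∷ []

-- 1 - z^k
oneMinusZPow : ℕ → Poly
oneMinusZPow k = (+ 1 ∷ []) ∷ (replicate (k Data.Nat.∸ 1) [] ++ ((-[1+ 0 ] ∷ []) ∷ []))

d : ℕ → ℕ → Poly
d r ℓ = foldr (λ j acc → factor (r + 2 * j) *P acc) oneP (upTo (suc ℓ))

-- d_{r,ℓ} / (1 - q^{r+2i} z) = ∏_{0≤j≤ℓ, j≠i} (1 - q^{r+2j} z)  (exact quotient)
dDiv : ℕ → ℕ → ℕ → Poly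
dDiv r ℓ i = foldr (λ j acc → (if ⌊ j ≟ i ⌋ then oneP else factor (r + 2 * j)) *P acc)
                   oneP (upTo (suc ℓ))

rhs : ℕ → Poly
rhs ℓ = foldr (λ k acc → oneMinusZPow (suc k) *P acc) oneP (upTo ℓ)

sumFin : (n : ℕ) → (Fin n → Poly) → Poly
sumFin zero f = zeroP
sumFin (suc n) f = f Fin.zero +P sumFin n (λ i → f (Fin.suc i))
  where import Data.Fin as Fin

module Submission where

-- Put x = q², r = 2s and Dᵢ = ∏_{j ≤ ℓ, j ≠ i} (1 - x^(s+j) z); the claim is that
-- (1 - z)⋯(1 - z^ℓ) is a combination ∑ pᵢ Dᵢ with all pᵢ non-zero, and apart from
-- non-vanishing this holds in any commutative ring, by induction on ℓ.  For
-- m = ℓ + 1 the cofactors D_{i+1} are (1 - x^s z) times the cofactors for (s + 1, ℓ),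
-- and for i ≤ ℓ the Dᵢ are the cofactors for (s, ℓ) times (1 - x^(s+m) z).  So it
-- suffices to write 1 - z^m as a combination of 1 - y and 1 - x^m y, where y = x^s z.
-- The geometric sums A = ∑_{k<m} y^k and B = ∑_{k<s} x^(mk) do it:
--   (A + x^m z^m B)(1 - y) - z^m B (1 - x^m y) = (1 - y^m) - z^m (1 - x^(ms)) = 1 - z^m,
-- because y^m = x^(ms) z^m (this is where r is even).
-- Adding cᵢ (1 - x^(s+i) z) to each pᵢ changes the sum by (∑ cᵢ) ∏ⱼ (1 - x^(s+j) z),
-- so any cᵢ with ∑ cᵢ = 0 may be added.  Taking cᵢ = wᵢ z^N, with N beyond the
-- z-degree of every pᵢ and non-zero integers wᵢ = (-ℓ, 1, …, 1) summing to 0,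
-- makes the coefficient of z^N q⁰ in the new pᵢ equal to wᵢ.

open import Level using (0ℓ)
open import Algebra.Bundles using (AbelianGroup; CommutativeRing; Monoid)
open import Data.Bool.Base using (true; false; if_then_else_)
open import Data.Fin.Base as Fin using (Fin; toℕ)
open import Data.Fin.Properties using (toℕ<n; toℕ-inject₁; toℕ-fromℕ)
open import Data.List.Base using (List; []; _∷_; [_]; _++_; map; replicate; length; foldr; applyUpTo)
open import Data.Nat.Base as ℕ using (ℕ; zero; suc; _≤_; _<_; s≤s)
import Data.Nat.Properties as ℕ
open import Data.Integer.Base as ℤ using (ℤ; +_; -[1+_])
import Data.Integer.Properties as ℤ
open import Data.Product.Base using (Σ; _×_; _,_; proj₁; proj₂)
open import Data.Nat.Divisibility using (_∣_; divides)
open import Relation.Binary.Structures using (IsEquivalence)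
open import Function.Base using (_∘_)
open import Relation.Binary.PropositionalEquality as ≡ using (_≡_; _≢_)
open import Relation.Nullary.Decidable using (Dec; ⌊_⌋; yes; no)
open import Relation.Nullary.Negation using (contradiction)

open import Defs

module ListPolynomial {ℓ} (R : CommutativeRing 0ℓ ℓ) where

  open CommutativeRing R renaming (Carrier to A)
  open ListPoly 0# _+_ _*_ public
  open import Algebra.Properties.Ring ring using (-0#≈0#)
  open import Relation.Binary.Reasoning.Setoid setoid

  infix 4 _≋_
  record _≋_ (xs ys : List A) : Set ℓ where
    constructor coeffwise
    field coeff-≈ : ∀ n → coeff xs n ≈ coeff ys n
  open _≋_ public

  negP : List A → List A
  negP = map (-_)

  ≋-refl : ∀ {xs} → xs ≋ xs
  ≋-refl = coeffwise λ _ → refl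

  ≋-sym : ∀ {xs ys} → xs ≋ ys → ys ≋ xs
  ≋-sym p = coeffwise λ n → sym (coeff-≈ p n)

  ≋-trans : ∀ {xs ys zs} → xs ≋ ys → ys ≋ zs → xs ≋ zs
  ≋-trans p q = coeffwise λ n → trans (coeff-≈ p n) (coeff-≈ q n)

  ≋-isEquivalence : IsEquivalence _≋_
  ≋-isEquivalence = record { refl = ≋-refl ; sym = ≋-sym ; trans = ≋-trans }

  ∷-cong : ∀ {x y xs ys} → x ≈ y → xs ≋ ys → x ∷ xs ≋ y ∷ ys
  ∷-cong x≈y xs≋ys = coeffwise λ { zero → x≈y ; (suc n) → coeff-≈ xs≋ys n }

  coeff-addP : ∀ xs ys n → coeff (addP xs ys) n ≈ coeff xs n + coeff ys n
  coeff-addP []       ys       n       = sym (+-identityˡ _)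
  coeff-addP (x ∷ xs) []       n       = sym (+-identityʳ _)
  coeff-addP (x ∷ xs) (y ∷ ys) zero    = refl
  coeff-addP (x ∷ xs) (y ∷ ys) (suc n) = coeff-addP xs ys n

  coeff-scaleP : ∀ a xs n → coeff (scaleP a xs) n ≈ a * coeff xs n
  coeff-scaleP a []       n       = sym (zeroʳ a)
  coeff-scaleP a (x ∷ xs) zero    = refl
  coeff-scaleP a (x ∷ xs) (suc n) = coeff-scaleP a xs n

  coeff-negP : ∀ xs n → coeff (negP xs) n ≈ - coeff xs n
  coeff-negP []       n       = sym -0#≈0#
  coeff-negP (x ∷ xs) zero    = refl
  coeff-negP (x ∷ xs) (suc n) = coeff-negP xs n

  addP-cong : ∀ {xs xs′ ys ys′} → xs ≋ xs′ → ys ≋ ys′ → addP xs ys ≋ addP xs′ ys′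
  addP-cong {xs} {xs′} {ys} {ys′} p q = coeffwise λ n →
    trans (coeff-addP xs ys n) (trans (+-cong (coeff-≈ p n) (coeff-≈ q n)) (sym (coeff-addP xs′ ys′ n)))

  addP-congˡ : ∀ xs {ys ys′} → ys ≋ ys′ → addP xs ys ≋ addP xs ys′
  addP-congˡ xs = addP-cong (≋-refl {xs})

  negP-cong : ∀ {xs ys} → xs ≋ ys → negP xs ≋ negP ys
  negP-cong {xs} {ys} p = coeffwise λ n →
    trans (coeff-negP xs n) (trans (-‿cong (coeff-≈ p n)) (sym (coeff-negP ys n)))

  addP-assoc : ∀ xs ys zs → addP (addP xs ys) zs ≋ addP xs (addP ys zs)
  addP-assoc xs ys zs = coeffwise λ n → begin
    coeff (addP (addP xs ys) zs) n          ≈⟨ coeff-addP (addP xs ys) zs n ⟩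
    coeff (addP xs ys) n + coeff zs n       ≈⟨ +-congʳ (coeff-addP xs ys n) ⟩
    (coeff xs n + coeff ys n) + coeff zs n  ≈⟨ +-assoc _ _ _ ⟩
    coeff xs n + (coeff ys n + coeff zs n)  ≈⟨ +-congˡ (coeff-addP ys zs n) ⟨
    coeff xs n + coeff (addP ys zs) n       ≈⟨ coeff-addP xs (addP ys zs) n ⟨
    coeff (addP xs (addP ys zs)) n          ∎

  addP-comm : ∀ xs ys → addP xs ys ≋ addP ys xs
  addP-comm xs ys = coeffwise λ n →
    trans (coeff-addP xs ys n) (trans (+-comm _ _) (sym (coeff-addP ys xs n)))

  addP-identityʳ : ∀ xs → addP xs [] ≋ xs
  addP-identityʳ xs = coeffwise λ n → trans (coeff-addP xs [] n) (+-identityʳ _)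

  negP-inverseˡ : ∀ xs → addP (negP xs) xs ≋ []
  negP-inverseˡ xs = coeffwise λ n →
    trans (coeff-addP (negP xs) xs n) (trans (+-congʳ (coeff-negP xs n)) (-‿inverseˡ _))

  negP-inverseʳ : ∀ xs → addP xs (negP xs) ≋ []
  negP-inverseʳ xs = ≋-trans (addP-comm xs (negP xs)) (negP-inverseˡ xs)

  +-abelianGroupP : AbelianGroup 0ℓ ℓ
  +-abelianGroupP = record
    { Carrier = List A
    ; _≈_ = _≋_
    ; _∙_ = addP
    ; ε = []
    ; _⁻¹ = negP
    ; isAbelianGroup = record
      { isGroup = record
        { isMonoid = record
          { isSemigroup = record
            { isMagma = record { isEquivalence = ≋-isEquivalence ; ∙-cong = addP-cong }
            ; assoc = addP-assoc }
          ; identity = (λ _ → ≋-refl) , addP-identityʳ }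
        ; inverse = negP-inverseˡ , negP-inverseʳ
        ; ⁻¹-cong = negP-cong }
      ; comm = addP-comm } }

  open import Algebra.Properties.CommutativeSemigroup (AbelianGroup.commutativeSemigroup +-abelianGroupP)
    using () renaming (interchange to addP-interchange; x∙yz≈y∙xz to addP-x∙yz≈y∙xz)

  [0#]≋[] : 0# ∷ [] ≋ []
  [0#]≋[] = coeffwise λ { zero → refl ; (suc n) → refl }

  0∷-addP : ∀ xs ys → 0# ∷ addP xs ys ≋ addP (0# ∷ xs) (0# ∷ ys)
  0∷-addP xs ys = ∷-cong (sym (+-identityʳ 0#)) ≋-refl

  scaleP-cong : ∀ {a b xs ys} → a ≈ b → xs ≋ ys → scaleP a xs ≋ scaleP b ys
  scaleP-cong {a} {b} {xs} {ys} a≈b p = coeffwise λ n →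
    trans (coeff-scaleP a xs n) (trans (*-cong a≈b (coeff-≈ p n)) (sym (coeff-scaleP b ys n)))

  scaleP-zero : ∀ xs → scaleP 0# xs ≋ []
  scaleP-zero xs = coeffwise λ n → trans (coeff-scaleP 0# xs n) (zeroˡ _)

  scaleP-identity : ∀ xs → scaleP 1# xs ≋ xs
  scaleP-identity xs = coeffwise λ n → trans (coeff-scaleP 1# xs n) (*-identityˡ _)

  scaleP-scaleP : ∀ a b xs → scaleP a (scaleP b xs) ≋ scaleP (a * b) xs
  scaleP-scaleP a b xs = coeffwise λ n → begin
    coeff (scaleP a (scaleP b xs)) n  ≈⟨ coeff-scaleP a (scaleP b xs) n ⟩
    a * coeff (scaleP b xs) n         ≈⟨ *-congˡ (coeff-scaleP b xs n) ⟩
    a * (b * coeff xs n)              ≈⟨ *-assoc a b _ ⟨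
    (a * b) * coeff xs n              ≈⟨ coeff-scaleP (a * b) xs n ⟨
    coeff (scaleP (a * b) xs) n       ∎

  scaleP-addP : ∀ a xs ys → scaleP a (addP xs ys) ≋ addP (scaleP a xs) (scaleP a ys)
  scaleP-addP a xs ys = coeffwise λ n → begin
    coeff (scaleP a (addP xs ys)) n                ≈⟨ coeff-scaleP a (addP xs ys) n ⟩
    a * coeff (addP xs ys) n                       ≈⟨ *-congˡ (coeff-addP xs ys n) ⟩
    a * (coeff xs n + coeff ys n)                  ≈⟨ distribˡ a _ _ ⟩
    a * coeff xs n + a * coeff ys n                ≈⟨ +-cong (coeff-scaleP a xs n) (coeff-scaleP a ys n) ⟨
    coeff (scaleP a xs) n + coeff (scaleP a ys) n  ≈⟨ coeff-addP (scaleP a xs) (scaleP a ys) n ⟨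
    coeff (addP (scaleP a xs) (scaleP a ys)) n     ∎

  mulP-congʳ : ∀ xs {ys ys′} → ys ≋ ys′ → mulP xs ys ≋ mulP xs ys′
  mulP-congʳ []       p = ≋-refl
  mulP-congʳ (x ∷ xs) p = addP-cong (scaleP-cong refl p) (∷-cong refl (mulP-congʳ xs p))

  mulP-zeroʳ : ∀ xs → mulP xs [] ≋ []
  mulP-zeroʳ []       = ≋-refl
  mulP-zeroʳ (x ∷ xs) = coeffwise λ { zero → refl ; (suc n) → coeff-≈ (mulP-zeroʳ xs) n }

  mulP-consʳ : ∀ xs y ys → mulP xs (y ∷ ys) ≋ addP (scaleP y xs) (0# ∷ mulP xs ys)
  mulP-consʳ []       y ys = ≋-sym [0#]≋[]
  mulP-consʳ (x ∷ xs) y ys = ∷-cong (+-congʳ (*-comm x y)) (≋-trans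
    (addP-congˡ (scaleP x ys) (mulP-consʳ xs y ys))
    (addP-x∙yz≈y∙xz (scaleP x ys) (scaleP y xs) (0# ∷ mulP xs ys)))

  mulP-comm : ∀ xs ys → mulP xs ys ≋ mulP ys xs
  mulP-comm xs []       = mulP-zeroʳ xs
  mulP-comm xs (y ∷ ys) =
    ≋-trans (mulP-consʳ xs y ys) (addP-congˡ (scaleP y xs) (∷-cong refl (mulP-comm xs ys)))

  mulP-congˡ : ∀ {xs xs′} ys → xs ≋ xs′ → mulP xs ys ≋ mulP xs′ ys
  mulP-congˡ {xs} {xs′} ys p =
    ≋-trans (mulP-comm xs ys) (≋-trans (mulP-congʳ ys p) (mulP-comm ys xs′))

  mulP-distribˡ : ∀ xs ys zs → mulP xs (addP ys zs) ≋ addP (mulP xs ys) (mulP xs zs)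
  mulP-distribˡ []       ys zs = ≋-refl
  mulP-distribˡ (x ∷ xs) ys zs = ≋-trans
    (addP-cong (scaleP-addP x ys zs) (≋-trans (∷-cong refl (mulP-distribˡ xs ys zs)) (0∷-addP (mulP xs ys) (mulP xs zs))))
    (addP-interchange (scaleP x ys) (scaleP x zs) (0# ∷ mulP xs ys) (0# ∷ mulP xs zs))

  mulP-distribʳ : ∀ xs ys zs → mulP (addP ys zs) xs ≋ addP (mulP ys xs) (mulP zs xs)
  mulP-distribʳ xs ys zs = ≋-trans (mulP-comm (addP ys zs) xs) (≋-trans
    (mulP-distribˡ xs ys zs) (addP-cong (mulP-comm xs ys) (mulP-comm xs zs)))

  mulP-0∷ : ∀ xs ys → mulP (0# ∷ xs) ys ≋ 0# ∷ mulP xs ys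
  mulP-0∷ xs ys = addP-cong (scaleP-zero ys) ≋-refl

  mulP-const : ∀ a ys → mulP (a ∷ []) ys ≋ scaleP a ys
  mulP-const a ys = ≋-trans (addP-congˡ (scaleP a ys) [0#]≋[]) (addP-identityʳ (scaleP a ys))

  mulP-scaleP : ∀ a xs ys → mulP (scaleP a xs) ys ≋ scaleP a (mulP xs ys)
  mulP-scaleP a []       ys = ≋-refl
  mulP-scaleP a (x ∷ xs) ys = ≋-trans
    (addP-cong (≋-sym (scaleP-scaleP a x ys)) (∷-cong (sym (zeroʳ a)) (mulP-scaleP a xs ys)))
    (≋-sym (scaleP-addP a (scaleP x ys) (0# ∷ mulP xs ys)))

  mulP-assoc : ∀ xs ys zs → mulP (mulP xs ys) zs ≋ mulP xs (mulP ys zs)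
  mulP-assoc []       ys zs = ≋-refl
  mulP-assoc (x ∷ xs) ys zs = ≋-trans
    (mulP-distribʳ zs (scaleP x ys) (0# ∷ mulP xs ys))
    (addP-cong (mulP-scaleP x ys zs) (≋-trans (mulP-0∷ (mulP xs ys) zs) (∷-cong refl (mulP-assoc xs ys zs))))

  mulP-identityˡ : ∀ xs → mulP (1# ∷ []) xs ≋ xs
  mulP-identityˡ xs = ≋-trans (mulP-const 1# xs) (scaleP-identity xs)

  commutativeRing : CommutativeRing 0ℓ ℓ
  commutativeRing = record
    { isCommutativeRing = record
      { isRing = record
        { +-isAbelianGroup = AbelianGroup.isAbelianGroup +-abelianGroupP
        ; *-cong = λ {xs} {xs′} {ys} {ys′} p q → ≋-trans (mulP-congˡ ys p) (mulP-congʳ xs′ q)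
        ; *-assoc = mulP-assoc
        ; *-identity = mulP-identityˡ , λ xs → ≋-trans (mulP-comm xs (1# ∷ [])) (mulP-identityˡ xs)
        ; distrib = mulP-distribˡ , mulP-distribʳ }
      ; *-comm = mulP-comm } }

  open import Algebra.Properties.Semiring.Exp semiring using (_^_)
  open import Algebra.Properties.Semiring.Exp (CommutativeRing.semiring commutativeRing)
    using () renaming (_^_ to _^P_)

  X : List A
  X = 0# ∷ 1# ∷ []

  monomial : ℕ → A → List A
  monomial n a = replicate n 0# ++ [ a ]

  X-* : ∀ xs → mulP X xs ≋ 0# ∷ xs
  X-* xs = ≋-trans (mulP-0∷ [ 1# ] xs) (∷-cong refl (mulP-identityˡ xs))

  X^n≋monomial : ∀ n → X ^P n ≋ monomial n 1#
  X^n≋monomial zero    = ≋-refl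
  X^n≋monomial (suc n) = ≋-trans (X-* (X ^P n)) (∷-cong refl (X^n≋monomial n))

  negP-monomial : ∀ n a → negP (monomial n a) ≋ monomial n (- a)
  negP-monomial zero    a = ≋-refl
  negP-monomial (suc n) a = ∷-cong -0#≈0# (negP-monomial n a)

  [_]^n : ∀ a n → [ a ] ^P n ≋ [ a ^ n ]
  [ a ]^n zero    = ≋-refl
  [ a ]^n (suc n) = ≋-trans (mulP-congʳ [ a ] ([ a ]^n n)) (mulP-const a [ a ^ n ])

  coeff-X^-* : ∀ m xs n → coeff (mulP (X ^P m) xs) (m ℕ.+ n) ≈ coeff xs n
  coeff-X^-* zero    xs n = coeff-≈ (mulP-identityˡ xs) n
  coeff-X^-* (suc m) xs n = trans
    (coeff-≈ (≋-trans (mulP-assoc X (X ^P m) xs) (X-* (mulP (X ^P m) xs))) (suc (m ℕ.+ n)))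
    (coeff-X^-* m xs n)

  length≤⇒coeff≡0# : ∀ xs {n} → length xs ≤ n → coeff xs n ≡ 0#
  length≤⇒coeff≡0# []       _           = ≡.refl
  length≤⇒coeff≡0# (x ∷ xs) (s≤s len≤n) = length≤⇒coeff≡0# xs len≤n

lengthSum : ∀ {A : Set} → ℕ → (ℕ → List A) → ℕ
lengthSum zero    p = 0
lengthSum (suc n) p = length (p 0) ℕ.+ lengthSum n (p ∘ suc)

length≤lengthSum : ∀ {A : Set} n (p : ℕ → List A) i → i < n → length (p i) ≤ lengthSum n p
length≤lengthSum (suc n) p zero    _         = ℕ.m≤m+n _ _
length≤lengthSum (suc n) p (suc i) (s≤s i<n) = ℕ.≤-trans (length≤lengthSum n (p ∘ suc) i i<n) (ℕ.m≤n+m _ _)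

-- Written with ⌊ j ≟ i ⌋ so that dDiv unfolds to a product of (factor [ i ]≔ oneP) j.
_[_]≔_ : ∀ {a} {A : Set a} → (ℕ → A) → ℕ → A → ℕ → A
(f [ i ]≔ a) j = if ⌊ j ℕ.≟ i ⌋ then a else f j

[]≔-updates : ∀ {a} {A : Set a} (f : ℕ → A) i x → (f [ i ]≔ x) i ≡ x
[]≔-updates f i x with i ℕ.≟ i
... | yes _   = ≡.refl
... | no  i≢i = contradiction ≡.refl i≢i

[]≔-minimal : ∀ {a} {A : Set a} (f : ℕ → A) {i j} x → j ≢ i → (f [ i ]≔ x) j ≡ f j
[]≔-minimal f {i} {j} x j≢i with j ℕ.≟ i
... | yes j≡i = contradiction j≡i j≢i
... | no  _   = ≡.refl

[]≔-suc : ∀ {a} {A : Set a} (f : ℕ → A) i x j → (f [ suc i ]≔ x) (suc j) ≡ ((f ∘ suc) [ i ]≔ x) j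
[]≔-suc f i x j = by-cases (j ℕ.≟ i)
  where
  by-cases : Dec (j ≡ i) → (f [ suc i ]≔ x) (suc j) ≡ ((f ∘ suc) [ i ]≔ x) j
  by-cases (yes ≡.refl) = ≡.trans ([]≔-updates f (suc j) x) (≡.sym ([]≔-updates (f ∘ suc) j x))
  by-cases (no  j≢i)    = ≡.trans ([]≔-minimal f x (j≢i ∘ ℕ.suc-injective)) (≡.sym ([]≔-minimal (f ∘ suc) x j≢i))

_◂_ : ∀ {a} {A : Set a} → A → (ℕ → A) → ℕ → A
(x ◂ f) zero    = x
(x ◂ f) (suc i) = f i

module _ {c ℓ} (M : Monoid c ℓ) where

  open Monoid M
  open import Algebra.Properties.Monoid.Sum M using (sum; sum-cong-≋; sum-init-last)

  foldr-applyUpTo : ∀ (f : ℕ → Carrier) g n →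
    foldr (λ j acc → f j ∙ acc) ε (applyUpTo g n) ≡ sum {n} (f ∘ g ∘ toℕ)
  foldr-applyUpTo f g zero    = ≡.refl
  foldr-applyUpTo f g (suc n) = ≡.cong (f (g 0) ∙_) (foldr-applyUpTo f (g ∘ suc) n)

  sum∘toℕ-init-last : ∀ n (f : ℕ → Carrier) → sum {suc n} (f ∘ toℕ) ≈ sum {n} (f ∘ toℕ) ∙ f n
  sum∘toℕ-init-last n f = trans (sum-init-last (f ∘ toℕ)) (∙-cong
    (sum-cong-≋ {n} λ i → reflexive (≡.cong f (toℕ-inject₁ i)))
    (reflexive (≡.cong f (toℕ-fromℕ n))))

module Cofactors {c ℓ} (R : CommutativeRing c ℓ) where

  open CommutativeRing R
  open import Algebra.Properties.CommutativeSemiring.Exp commutativeSemiring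
  open import Algebra.Properties.Semiring.Sum semiring
  open import Algebra.Properties.CommutativeMonoid.Sum *-commutativeMonoid
    using () renaming (sum to prod; sum-cong-≋ to prod-cong-≋)
  open import Algebra.Properties.CommutativeSemigroup *-commutativeSemigroup using (x∙yz≈y∙xz; x∙yz≈z∙xy; xy∙z≈y∙xz)
  open import Algebra.Properties.Ring ring using (-‿distribˡ-*; -‿distribʳ-*; x[y-z]≈xy-xz)
  open import Algebra.Properties.AbelianGroup +-abelianGroup using (⁻¹-anti-homo‿-)
  open import Relation.Binary.Reasoning.Setoid setoid

  [x-y]+[y-z]≈x-z : ∀ a b c → (a - b) + (b - c) ≈ a - c
  [x-y]+[y-z]≈x-z a b c = begin
    (a - b) + (b - c)    ≈⟨ +-assoc a (- b) (b - c) ⟩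
    a + (- b + (b - c))  ≈⟨ +-congˡ (+-assoc (- b) b (- c)) ⟨
    a + ((- b + b) - c)  ≈⟨ +-congˡ (+-congʳ (-‿inverseˡ b)) ⟩
    a + (0# - c)         ≈⟨ +-congˡ (+-identityˡ (- c)) ⟩
    a - c                ∎

  [x-z]-[y-z]≈x-y : ∀ a b c → (a - c) - (b - c) ≈ a - b
  [x-z]-[y-z]≈x-y a b c = trans (+-congˡ (⁻¹-anti-homo‿- b c)) ([x-y]+[y-z]≈x-z a c b)

  [xa+yb]c≈x[ac]+y[bc] : ∀ x y a b c → (x * a + y * b) * c ≈ x * (a * c) + y * (b * c)
  [xa+yb]c≈x[ac]+y[bc] x y a b c = trans (distribʳ c _ _) (+-cong (*-assoc x a c) (*-assoc y b c))

  prodExcept : ℕ → (ℕ → Carrier) → ℕ → Carrier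
  prodExcept n f i = prod {n} ((f [ i ]≔ 1#) ∘ toℕ)

  prodExcept-cong : ∀ n {f g} → (∀ j → f j ≈ g j) → ∀ i → prodExcept n f i ≈ prodExcept n g i
  prodExcept-cong n {f} {g} f≈g i = prod-cong-≋ {n} (λ j → update-cong (toℕ j))
    where
    update-cong : ∀ j → (f [ i ]≔ 1#) j ≈ (g [ i ]≔ 1#) j
    update-cong j with ⌊ j ℕ.≟ i ⌋
    ... | true  = refl
    ... | false = f≈g j

  prodExcept-suc : ∀ n f i → prodExcept (suc n) f (suc i) ≈ f 0 * prodExcept n (f ∘ suc) i
  prodExcept-suc n f i = *-congˡ (prod-cong-≋ {n} λ j → reflexive ([]≔-suc f i 1# (toℕ j)))

  *-prodExcept : ∀ n f i → i < n → f i * prodExcept n f i ≈ prod {n} (f ∘ toℕ)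
  *-prodExcept (suc n) f zero    _           = *-congˡ (*-identityˡ _)
  *-prodExcept (suc n) f (suc i) (s≤s i<n) = begin
    f (suc i) * prodExcept (suc n) f (suc i)      ≈⟨ *-congˡ (prodExcept-suc n f i) ⟩
    f (suc i) * (f 0 * prodExcept n (f ∘ suc) i)  ≈⟨ x∙yz≈y∙xz _ _ _ ⟩
    f 0 * (f (suc i) * prodExcept n (f ∘ suc) i)  ≈⟨ *-congˡ (*-prodExcept n (f ∘ suc) i i<n) ⟩
    f 0 * prod {n} (f ∘ suc ∘ toℕ)                ∎

  prodExcept-last : ∀ n f i → i < n → prodExcept (suc n) f i ≈ prodExcept n f i * f n
  prodExcept-last n f i i<n = trans (sum∘toℕ-init-last *-monoid n (f [ i ]≔ 1#))
    (*-congˡ (reflexive ([]≔-minimal f 1# (ℕ.>⇒≢ i<n))))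

  cofactorSum : ℕ → (ℕ → Carrier) → (ℕ → Carrier) → Carrier
  cofactorSum n f p = ∑[ i < n ] (p (toℕ i) * prodExcept n f (toℕ i))

  cofactorSum-cong : ∀ n {f g} p → (∀ j → f j ≈ g j) → cofactorSum n f p ≈ cofactorSum n g p
  cofactorSum-cong n p f≈g = sum-cong-≋ {n} λ i → *-congˡ (prodExcept-cong n f≈g (toℕ i))

  cofactorSum-linear : ∀ n f a b α β →
    cofactorSum n f (λ i → α * a i + β * b i) ≈ α * cofactorSum n f a + β * cofactorSum n f b
  cofactorSum-linear n f a b α β = begin
    cofactorSum n f (λ i → α * a i + β * b i)        ≈⟨ sum-cong-≋ {n} (λ i → [xa+yb]c≈x[ac]+y[bc] α β _ _ _) ⟩
    ∑[ i < n ] (α * A i + β * B i)               ≈⟨ ∑-distrib-+ {n} (λ i → α * A i) (λ i → β * B i) ⟩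
    ∑[ i < n ] (α * A i) + ∑[ i < n ] (β * B i)  ≈⟨ +-cong (*-distribˡ-sum {n} α A) (*-distribˡ-sum {n} β B) ⟨
    α * cofactorSum n f a + β * cofactorSum n f b        ∎
    where
    A B : Fin n → Carrier
    A i = a (toℕ i) * prodExcept n f (toℕ i)
    B i = b (toℕ i) * prodExcept n f (toℕ i)

  cofactorSum-perturb : ∀ n f p c → ∑[ i < n ] c (toℕ i) ≈ 0# →
    cofactorSum n f (λ i → p i + c i * f i) ≈ cofactorSum n f p
  cofactorSum-perturb n f p c ∑c≈0 = begin
    cofactorSum n f (λ i → p i + c i * f i)  ≈⟨ sum-cong-≋ {n} (λ i → perturb (toℕ i) (toℕ<n i)) ⟩
    ∑[ i < n ] (P i + C i)               ≈⟨ ∑-distrib-+ {n} P C ⟩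
    cofactorSum n f p + ∑[ i < n ] C i       ≈⟨ +-congˡ (*-distribʳ-sum {n} ∏f (c ∘ toℕ)) ⟨
    cofactorSum n f p + ∑[ i < n ] c (toℕ i) * ∏f
                                         ≈⟨ +-congˡ (trans (*-congʳ ∑c≈0) (zeroˡ ∏f)) ⟩
    cofactorSum n f p + 0#                   ≈⟨ +-identityʳ _ ⟩
    cofactorSum n f p                        ∎
    where
    ∏f = prod {n} (f ∘ toℕ)
    P C : Fin n → Carrier
    P i = p (toℕ i) * prodExcept n f (toℕ i)
    C i = c (toℕ i) * ∏f
    perturb : ∀ i → i < n → (p i + c i * f i) * prodExcept n f i ≈ p i * prodExcept n f i + c i * ∏f
    perturb i i<n = trans (distribʳ _ (p i) _)
      (+-congˡ (trans (*-assoc (c i) (f i) _) (*-congˡ (*-prodExcept n f i i<n))))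

  cofactorSum-shift : ∀ n f u → cofactorSum (suc n) f (0# ◂ u) ≈ f 0 * cofactorSum n (f ∘ suc) u
  cofactorSum-shift n f u = begin
    0# * prodExcept (suc n) f 0 + ∑[ i < n ] U i  ≈⟨ +-cong (zeroˡ _) (sum-cong-≋ {n} (λ i → shift (toℕ i))) ⟩
    0# + ∑[ i < n ] (f 0 * U′ i)                  ≈⟨ +-identityˡ _ ⟩
    ∑[ i < n ] (f 0 * U′ i)                       ≈⟨ *-distribˡ-sum {n} (f 0) U′ ⟨
    f 0 * cofactorSum n (f ∘ suc) u                   ∎
    where
    U U′ : Fin n → Carrier
    U  i = u (toℕ i) * prodExcept (suc n) f (suc (toℕ i))
    U′ i = u (toℕ i) * prodExcept n (f ∘ suc) (toℕ i)
    shift : ∀ i → u i * prodExcept (suc n) f (suc i) ≈ f 0 * (u i * prodExcept n (f ∘ suc) i)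
    shift i = trans (*-congˡ (prodExcept-suc n f i)) (x∙yz≈y∙xz _ _ _)

  cofactorSum-extend : ∀ n f v → cofactorSum (suc n) f (v [ n ]≔ 0#) ≈ f n * cofactorSum n f v
  cofactorSum-extend n f v = begin
    cofactorSum (suc n) f v′
      ≈⟨ sum∘toℕ-init-last +-monoid n (λ i → v′ i * prodExcept (suc n) f i) ⟩
    ∑[ i < n ] (v′ (toℕ i) * prodExcept (suc n) f (toℕ i)) + v′ n * prodExcept (suc n) f n
      ≈⟨ +-cong (sum-cong-≋ {n} (λ i → extend (toℕ i) (toℕ<n i)))
                (trans (*-congʳ (reflexive ([]≔-updates v n 0#))) (zeroˡ _)) ⟩
    ∑[ i < n ] (f n * V i) + 0#
      ≈⟨ +-identityʳ _ ⟩
    ∑[ i < n ] (f n * V i)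
      ≈⟨ *-distribˡ-sum {n} (f n) V ⟨
    f n * cofactorSum n f v
      ∎
    where
    v′ = v [ n ]≔ 0#
    V : Fin n → Carrier
    V i = v (toℕ i) * prodExcept n f (toℕ i)
    extend : ∀ i → i < n → v′ i * prodExcept (suc n) f i ≈ f n * (v i * prodExcept n f i)
    extend i i<n = trans
      (*-cong (reflexive ([]≔-minimal v 0# (ℕ.<⇒≢ i<n))) (prodExcept-last n f i i<n))
      (x∙yz≈z∙xy _ _ _)

  geometricSum : Carrier → ℕ → Carrier
  geometricSum y zero    = 0#
  geometricSum y (suc n) = 1# + y * geometricSum y n

  [1-y]*geometricSum : ∀ y n → (1# - y) * geometricSum y n ≈ 1# - y ^ n
  [1-y]*geometricSum y zero    = trans (zeroʳ _) (sym (-‿inverseʳ 1#))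
  [1-y]*geometricSum y (suc n) = begin
    (1# - y) * (1# + y * G)               ≈⟨ distribˡ _ _ _ ⟩
    (1# - y) * 1# + (1# - y) * (y * G)    ≈⟨ +-cong (*-identityʳ _) (x∙yz≈y∙xz _ _ _) ⟩
    (1# - y) + y * ((1# - y) * G)         ≈⟨ +-congˡ (*-congˡ ([1-y]*geometricSum y n)) ⟩
    (1# - y) + y * (1# - y ^ n)           ≈⟨ +-congˡ (trans (x[y-z]≈xy-xz y 1# _) (+-congʳ (*-identityʳ y))) ⟩
    (1# - y) + (y - y ^ suc n)            ≈⟨ [x-y]+[y-z]≈x-z 1# y _ ⟩
    1# - y ^ suc n                        ∎
    where G = geometricSum y n

  module _ (x z : Carrier) where

    linearFactor : ℕ → ℕ → Carrier
    linearFactor t j = 1# - x ^ (t ℕ.+ j) * z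

    linearFactor-suc : ∀ t j → linearFactor t (suc j) ≈ linearFactor (suc t) j
    linearFactor-suc t j = reflexive (≡.cong (λ k → 1# - x ^ k * z) (ℕ.+-suc t j))

    bezoutˡ bezoutʳ : ℕ → ℕ → Carrier
    bezoutˡ t n = geometricSum (x ^ t * z) n + x ^ n * (z ^ n * geometricSum (x ^ n) t)
    bezoutʳ t n = - (z ^ n * geometricSum (x ^ n) t)

    bezout : ∀ t n → bezoutˡ t n * linearFactor t 0 + bezoutʳ t n * linearFactor t n ≈ 1# - z ^ n
    bezout t n = begin
      (A + Q * W) * linearFactor t 0 + - W * linearFactor t n
        ≈⟨ +-cong (*-congˡ factor₀) (*-congˡ factorₙ) ⟩
      (A + Q * W) * (1# - y) + - W * (1# - Q * y)
        ≈⟨ regroup ⟩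
      A * (1# - y) + W * (Q * (1# - y) - (1# - Q * y))
        ≈⟨ +-congˡ (*-congˡ Q[1-y]-[1-Qy]≈Q-1) ⟩
      A * (1# - y) + W * (Q - 1#)
        ≈⟨ +-cong (*-comm A _) W[Q-1]≈-Z[1-Q]B ⟩
      (1# - y) * A - Z * ((1# - Q) * B)
        ≈⟨ +-cong ([1-y]*geometricSum y n) (-‿cong (*-congˡ ([1-y]*geometricSum Q t))) ⟩
      (1# - y ^ n) - Z * (1# - Q ^ t)
        ≈⟨ +-congʳ (+-congˡ (-‿cong y^n≈Q^tZ)) ⟩
      (1# - Q ^ t * Z) - Z * (1# - Q ^ t)
        ≈⟨ +-congˡ (-‿cong (trans (x[y-z]≈xy-xz Z 1# _) (+-cong (*-identityʳ Z) (-‿cong (*-comm Z _))))) ⟩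
      (1# - Q ^ t * Z) - (Z - Q ^ t * Z)
        ≈⟨ [x-z]-[y-z]≈x-y 1# Z _ ⟩
      1# - Z
        ∎
      where
      y = x ^ t * z
      Q = x ^ n
      Z = z ^ n
      A = geometricSum y n
      B = geometricSum Q t
      W = Z * B

      factor₀ : linearFactor t 0 ≈ 1# - y
      factor₀ = reflexive (≡.cong (λ k → 1# - x ^ k * z) (ℕ.+-identityʳ t))

      factorₙ : linearFactor t n ≈ 1# - Q * y
      factorₙ = +-congˡ (-‿cong (trans (*-congʳ (^-homo-* x t n)) (xy∙z≈y∙xz _ _ _)))

      y^n≈Q^tZ : y ^ n ≈ Q ^ t * Z
      y^n≈Q^tZ = begin
        (x ^ t * z) ^ n    ≈⟨ ^-distrib-* _ z n ⟩
        (x ^ t) ^ n * Z    ≈⟨ *-congʳ (^-assocʳ x t n) ⟩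
        x ^ (t ℕ.* n) * Z  ≡⟨ ≡.cong (λ k → x ^ k * Z) (ℕ.*-comm t n) ⟩
        x ^ (n ℕ.* t) * Z  ≈⟨ *-congʳ (^-assocʳ x n t) ⟨
        Q ^ t * Z          ∎

      regroup : (A + Q * W) * (1# - y) + - W * (1# - Q * y) ≈ A * (1# - y) + W * (Q * (1# - y) - (1# - Q * y))
      regroup = begin
        (A + Q * W) * (1# - y) + - W * (1# - Q * y)
          ≈⟨ +-congʳ (distribʳ _ A _) ⟩
        (A * (1# - y) + Q * W * (1# - y)) + - W * (1# - Q * y)
          ≈⟨ +-assoc _ _ _ ⟩
        A * (1# - y) + (Q * W * (1# - y) + - W * (1# - Q * y))
          ≈⟨ +-congˡ (+-cong (xy∙z≈y∙xz Q W _) (trans (sym (-‿distribˡ-* W _)) (-‿distribʳ-* W _))) ⟩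
        A * (1# - y) + (W * (Q * (1# - y)) + W * - (1# - Q * y))
          ≈⟨ +-congˡ (distribˡ W _ _) ⟨
        A * (1# - y) + W * (Q * (1# - y) - (1# - Q * y))
          ∎

      Q[1-y]-[1-Qy]≈Q-1 : Q * (1# - y) - (1# - Q * y) ≈ Q - 1#
      Q[1-y]-[1-Qy]≈Q-1 = trans
        (+-congʳ (trans (x[y-z]≈xy-xz Q 1# y) (+-congʳ (*-identityʳ Q))))
        ([x-z]-[y-z]≈x-y Q 1# (Q * y))

      W[Q-1]≈-Z[1-Q]B : W * (Q - 1#) ≈ - (Z * ((1# - Q) * B))
      W[Q-1]≈-Z[1-Q]B = begin
        W * (Q - 1#)             ≈⟨ *-congˡ (⁻¹-anti-homo‿- 1# Q) ⟨
        W * - (1# - Q)           ≈⟨ -‿distribʳ-* W _ ⟨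
        - (Z * B * (1# - Q))     ≈⟨ -‿cong (trans (*-assoc Z B _) (*-congˡ (*-comm B _))) ⟩
        - (Z * ((1# - Q) * B))   ∎

    pochhammer : ℕ → Carrier
    pochhammer ℓ = prod {ℓ} (λ k → 1# - z ^ suc (toℕ k))

    ∃cofactorSum≈pochhammer : ∀ ℓ t → Σ (ℕ → Carrier) λ p → cofactorSum (suc ℓ) (linearFactor t) p ≈ pochhammer ℓ
    ∃cofactorSum≈pochhammer zero    t = (λ _ → 1#) , trans (+-identityʳ _) (trans (*-identityˡ _) (*-identityˡ _))
    ∃cofactorSum≈pochhammer (suc ℓ) t with ∃cofactorSum≈pochhammer ℓ (suc t) | ∃cofactorSum≈pochhammer ℓ t
    ... | u , ∑u≈Φ | v , ∑v≈Φ = (λ i → α * u′ i + β * v′ i) , (begin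
      cofactorSum (suc m) F (λ i → α * u′ i + β * v′ i)
        ≈⟨ cofactorSum-linear (suc m) F u′ v′ α β ⟩
      α * cofactorSum (suc m) F u′ + β * cofactorSum (suc m) F v′
        ≈⟨ +-cong (*-congˡ (cofactorSum-shift m F u)) (*-congˡ (cofactorSum-extend m F v)) ⟩
      α * (F 0 * cofactorSum m (F ∘ suc) u) + β * (F m * cofactorSum m F v)
        ≈⟨ +-cong (*-congˡ (*-congˡ (trans (cofactorSum-cong m u (linearFactor-suc t)) ∑u≈Φ)))
                  (*-congˡ (*-congˡ ∑v≈Φ)) ⟩
      α * (F 0 * Φ) + β * (F m * Φ)
        ≈⟨ [xa+yb]c≈x[ac]+y[bc] α β (F 0) (F m) Φ ⟨
      (α * F 0 + β * F m) * Φ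
        ≈⟨ *-congʳ (bezout t m) ⟩
      (1# - z ^ m) * Φ
        ≈⟨ *-comm _ Φ ⟩
      Φ * (1# - z ^ m)
        ≈⟨ sum∘toℕ-init-last *-monoid ℓ (λ k → 1# - z ^ suc k) ⟨
      pochhammer m
        ∎)
      where
      m = suc ℓ
      F = linearFactor t
      Φ = pochhammer ℓ
      α = bezoutˡ t m
      β = bezoutʳ t m
      u′ = 0# ◂ u
      v′ = v [ m ]≔ 0#

module ℤ[q]   = ListPolynomial ℤ.+-*-commutativeRing
module ℤ[q,z] = ListPolynomial ℤ[q].commutativeRing

open CommutativeRing ℤ[q,z].commutativeRing
  using (_≈_; _+_; _*_; _-_; 0#; 1#; sym; trans; reflexive; setoid; *-monoid;
         +-congˡ; *-congˡ; *-congʳ; *-comm; *-assoc; -‿cong; zeroˡ)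
open import Algebra.Properties.CommutativeSemiring.Exp (CommutativeRing.commutativeSemiring ℤ[q,z].commutativeRing)
  using (_^_; ^-assocʳ)
open import Algebra.Properties.Semiring.Exp (CommutativeRing.semiring ℤ[q].commutativeRing)
  using () renaming (_^_ to _^₁_)
open import Algebra.Properties.Semiring.Sum (CommutativeRing.semiring ℤ[q,z].commutativeRing)
  using (sum; sum-cong-≋; *-distribʳ-sum)
open import Algebra.Properties.CommutativeMonoid.Sum (CommutativeRing.*-commutativeMonoid ℤ[q,z].commutativeRing)
  using () renaming (sum-cong-≋ to prod-cong-≋)
open import Relation.Binary.Reasoning.Setoid setoid
open Cofactors ℤ[q,z].commutativeRing

-- With r = 2s, the factor 1 - q^(r+2j) z of d_{r,ℓ} is linearFactor x z s j.
q z x : Poly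
q = [ ℤ[q].X ]
z = ℤ[q,z].X
x = q ^ 2

factor≈ : ∀ n → factor n ≈ 1# - q ^ n * z
factor≈ n = sym (begin
  1# - q ^ n * z                        ≈⟨ +-congˡ {1#} (-‿cong q^nz≈) ⟩
  1# - ([] ∷ [ ℤ[q].monomial n (+ 1) ])  ≈⟨ ℤ[q,z].∷-cong ℤ[q].≋-refl
                                            (ℤ[q,z].∷-cong (ℤ[q].negP-monomial n (+ 1)) ℤ[q,z].≋-refl) ⟩
  factor n                              ∎)
  where
  q^nz≈ : q ^ n * z ≈ [] ∷ [ ℤ[q].monomial n (+ 1) ]
  q^nz≈ = begin
    q ^ n * z                         ≈⟨ *-congʳ (ℤ[q,z].[_]^n ℤ[q].X n) ⟩
    [ ℤ[q].X ^₁ n ] * z           ≈⟨ *-comm [ ℤ[q].X ^₁ n ] z ⟩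
    z * [ ℤ[q].X ^₁ n ]           ≈⟨ ℤ[q,z].X-* [ ℤ[q].X ^₁ n ] ⟩
    [] ∷ [ ℤ[q].X ^₁ n ]          ≈⟨ ℤ[q,z].∷-cong ℤ[q].≋-refl (ℤ[q,z].∷-cong (ℤ[q].X^n≋monomial n) ℤ[q,z].≋-refl) ⟩
    [] ∷ [ ℤ[q].monomial n (+ 1) ]     ∎

oneMinusZPow≈ : ∀ k → oneMinusZPow (suc k) ≈ 1# - z ^ suc k
oneMinusZPow≈ k = sym (begin
  1# - z ^ suc k                         ≈⟨ +-congˡ {1#} (-‿cong (ℤ[q,z].X^n≋monomial (suc k))) ⟩
  1# - ℤ[q,z].monomial (suc k) [ + 1 ]   ≈⟨ ℤ[q,z].∷-cong ℤ[q].≋-refl (ℤ[q,z].negP-monomial k [ + 1 ]) ⟩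
  oneMinusZPow (suc k)                   ∎)

factor-even≈ : ∀ k → factor (2 ℕ.* k) ≈ 1# - x ^ k * z
factor-even≈ k = trans (factor≈ (2 ℕ.* k)) (+-congˡ {1#} (-‿cong (*-congʳ (sym (^-assocʳ q 2 k)))))

factor≈linearFactor : ∀ {r s} → r ≡ s ℕ.* 2 → ∀ j → factor (r ℕ.+ 2 ℕ.* j) ≈ linearFactor x z s j
factor≈linearFactor {r} {s} r≡s*2 j = trans (reflexive (≡.cong factor r+2j≡2[s+j])) (factor-even≈ (s ℕ.+ j))
  where
  r+2j≡2[s+j] : r ℕ.+ 2 ℕ.* j ≡ 2 ℕ.* (s ℕ.+ j)
  r+2j≡2[s+j] = ≡.trans (≡.cong (ℕ._+ 2 ℕ.* j) (≡.trans r≡s*2 (ℕ.*-comm s 2))) (≡.sym (ℕ.*-distribˡ-+ 2 s j))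

dDiv≈prodExcept : ∀ {r s} → r ≡ s ℕ.* 2 → ∀ ℓ i → dDiv r ℓ i ≈ prodExcept (suc ℓ) (linearFactor x z s) i
dDiv≈prodExcept {r} {s} r≡s*2 ℓ i = trans
  (reflexive (foldr-applyUpTo *-monoid (factorᵣ [ i ]≔ 1#) (λ j → j) (suc ℓ)))
  (prodExcept-cong (suc ℓ) {factorᵣ} (factor≈linearFactor {r} {s} r≡s*2) i)
  where
  factorᵣ : ℕ → Poly
  factorᵣ j = factor (r ℕ.+ 2 ℕ.* j)

rhs≈pochhammer : ∀ ℓ → rhs ℓ ≈ pochhammer x z ℓ
rhs≈pochhammer ℓ = trans
  (reflexive (foldr-applyUpTo *-monoid (λ k → oneMinusZPow (suc k)) (λ k → k) ℓ))
  (prod-cong-≋ {ℓ} (λ k → oneMinusZPow≈ (toℕ k)))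

sumFin≡sum : ∀ n f → sumFin n f ≡ sum {n} f
sumFin≡sum zero    f = ≡.refl
sumFin≡sum (suc n) f = ≡.cong (_+_ (f Fin.zero)) (sumFin≡sum n (f ∘ Fin.suc))

≈⇒≈P : ∀ {a b} → a ≈ b → a ≈P b
≈⇒≈P a≈b j k = ℤ[q].coeff-≈ (ℤ[q,z].coeff-≈ a≈b j) k

cofactorSum≈pochhammer⇒sumFin≈rhs : ∀ {r s} → r ≡ s ℕ.* 2 → ∀ ℓ p →
  cofactorSum (suc ℓ) (linearFactor x z s) p ≈ pochhammer x z ℓ →
  sumFin (suc ℓ) (λ i → p (toℕ i) *P dDiv r ℓ (toℕ i)) ≈P rhs ℓ
cofactorSum≈pochhammer⇒sumFin≈rhs {r} {s} r≡s*2 ℓ p ∑≈Φ = ≈⇒≈P (begin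
  sumFin (suc ℓ) (λ i → p (toℕ i) * dDiv r ℓ (toℕ i))
    ≡⟨ sumFin≡sum (suc ℓ) (λ i → p (toℕ i) * dDiv r ℓ (toℕ i)) ⟩
  sum {suc ℓ} (λ i → p (toℕ i) * dDiv r ℓ (toℕ i))
    ≈⟨ sum-cong-≋ {suc ℓ} (λ i → *-congˡ {p (toℕ i)} (dDiv≈prodExcept {r} {s} r≡s*2 ℓ (toℕ i))) ⟩
  cofactorSum (suc ℓ) (linearFactor x z s) p
    ≈⟨ ∑≈Φ ⟩
  pochhammer x z ℓ
    ≈⟨ rhs≈pochhammer ℓ ⟨
  rhs ℓ
    ∎)

κ : ℤ → Poly
κ a = [ [ a ] ]

κ0≈0 : κ (+ 0) ≈ 0#
κ0≈0 = ℤ[q,z].coeffwise λ { zero → ℤ[q].[0#]≋[] ; (suc j) → ℤ[q].≋-refl }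

∑κ1≈κn : ∀ n → sum {n} (λ _ → κ (+ 1)) ≈ κ (+ n)
∑κ1≈κn zero    = sym κ0≈0
∑κ1≈κn (suc n) = +-congˡ {κ (+ 1)} (∑κ1≈κn n)

weight : ℕ → ℕ → ℤ
weight ℓ zero    = -[1+ ℓ ]
weight ℓ (suc _) = + 1

weight≢0 : ∀ ℓ i → weight ℓ i ≢ + 0
weight≢0 ℓ zero    ()
weight≢0 ℓ (suc i) ()

∑κweight≈0 : ∀ ℓ → sum {suc (suc ℓ)} (κ ∘ weight ℓ ∘ toℕ) ≈ 0#
∑κweight≈0 ℓ = begin
  κ -[1+ ℓ ] + sum {suc ℓ} (λ _ → κ (+ 1))  ≈⟨ +-congˡ {κ -[1+ ℓ ]} (∑κ1≈κn (suc ℓ)) ⟩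
  κ (-[1+ ℓ ] ℤ.+ + suc ℓ)                 ≡⟨ ≡.cong κ (ℤ.+-inverseˡ (+ suc ℓ)) ⟩
  κ (+ 0)                                  ≈⟨ κ0≈0 ⟩
  0#                                       ∎

coeff2-+ : ∀ a b j k → coeff2 (a + b) j k ≡ coeff2 a j k ℤ.+ coeff2 b j k
coeff2-+ a b j k = ≡.trans (ℤ[q].coeff-≈ (ℤ[q,z].coeff-addP a b j) k)
  (ℤ[q].coeff-addP (Z2.coeff a j) (Z2.coeff b j) k)

coeff2-κ* : ∀ w h j k → coeff2 (κ w * h) j k ≡ w ℤ.* coeff2 h j k
coeff2-κ* w h j k = ≡.trans
  (ℤ[q].coeff-≈ (ℤ[q].≋-trans (ℤ[q,z].coeff-≈ (ℤ[q,z].mulP-const [ w ] h) j)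
                              (ℤ[q,z].coeff-scaleP [ w ] h j)) k)
  (≡.trans (ℤ[q].coeff-≈ (ℤ[q].mulP-const w (Z2.coeff h j)) k) (ℤ[q].coeff-scaleP w (Z2.coeff h j) k))

coeff2-z^* : ∀ n g j k → coeff2 (z ^ n * g) (n ℕ.+ j) k ≡ coeff2 g j k
coeff2-z^* n g j k = ℤ[q].coeff-≈ (ℤ[q,z].coeff-X^-* n g j) k

coeff2-perturbed : ∀ p w g n → length p ≤ n → coeff2 (p + κ w * z ^ n * g) (n ℕ.+ 0) 0 ≡ w ℤ.* coeff2 g 0 0
coeff2-perturbed p w g n len≤n = ≡.trans (coeff2-+ p _ (n ℕ.+ 0) 0)
  (≡.trans (≡.cong₂ ℤ._+_ p[n]≡0 e[n]≡w*g[0]) (ℤ.+-identityˡ _))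
  where
  p[n]≡0 : coeff2 p (n ℕ.+ 0) 0 ≡ + 0
  p[n]≡0 = ≡.cong (λ c → Z1.coeff c 0)
    (ℤ[q,z].length≤⇒coeff≡0# p (ℕ.≤-trans len≤n (ℕ.m≤m+n n 0)))
  e[n]≡w*g[0] : coeff2 (κ w * z ^ n * g) (n ℕ.+ 0) 0 ≡ w ℤ.* coeff2 g 0 0
  e[n]≡w*g[0] = ≡.trans (≈⇒≈P (*-assoc (κ w) (z ^ n) g) (n ℕ.+ 0) 0)
    (≡.trans (coeff2-κ* w (z ^ n * g) (n ℕ.+ 0) 0) (≡.cong (w ℤ.*_) (coeff2-z^* n g 0 0)))

coeff2-linearFactor : ∀ t j → coeff2 (linearFactor x z t j) 0 0 ≡ + 1
coeff2-linearFactor t j = ≡.sym (≈⇒≈P (factor-even≈ (t ℕ.+ j)) 0 0)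

∃nonzero-cofactorSum≈pochhammer : ∀ ℓ s → Σ (ℕ → Poly) λ p →
  (∀ i → i < suc ℓ → NonZeroP (p i)) × cofactorSum (suc ℓ) (linearFactor x z s) p ≈ pochhammer x z ℓ
∃nonzero-cofactorSum≈pochhammer zero    s =
  (λ _ → 1#) , (λ _ _ 1≈0 → 1≢0 (1≈0 0 0)) , proj₂ (∃cofactorSum≈pochhammer x z zero s)
  where
  1≢0 : + 1 ≢ + 0
  1≢0 ()
∃nonzero-cofactorSum≈pochhammer (suc ℓ) s = p′ , p′≢0 , trans (cofactorSum-perturb (suc (suc ℓ)) F p c ∑c≈0) ∑p≈Φ
  where
  p = proj₁ (∃cofactorSum≈pochhammer x z (suc ℓ) s)
  ∑p≈Φ = proj₂ (∃cofactorSum≈pochhammer x z (suc ℓ) s)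
  F = linearFactor x z s
  N = lengthSum (suc (suc ℓ)) p
  c p′ : ℕ → Poly
  c i = κ (weight ℓ i) * z ^ N
  p′ i = p i + c i * F i

  ∑c≈0 : sum {suc (suc ℓ)} (c ∘ toℕ) ≈ 0#
  ∑c≈0 = trans (sym (*-distribʳ-sum {suc (suc ℓ)} (z ^ N) (κ ∘ weight ℓ ∘ toℕ)))
               (trans (*-congʳ (∑κweight≈0 ℓ)) (zeroˡ (z ^ N)))

  p′[N]≡weight : ∀ i → i < suc (suc ℓ) → coeff2 (p′ i) (N ℕ.+ 0) 0 ≡ weight ℓ i
  p′[N]≡weight i i<n = ≡.trans
    (coeff2-perturbed (p i) (weight ℓ i) (F i) N (length≤lengthSum (suc (suc ℓ)) p i i<n))
    (≡.trans (≡.cong (weight ℓ i ℤ.*_) (coeff2-linearFactor s i)) (ℤ.*-identityʳ (weight ℓ i)))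

  p′≢0 : ∀ i → i < suc (suc ℓ) → NonZeroP (p′ i)
  p′≢0 i i<n p′≈0 = weight≢0 ℓ i (≡.trans (≡.sym (p′[N]≡weight i i<n)) (p′≈0 (N ℕ.+ 0) 0))

corollary4p5 : (r ℓ : ℕ) → 0 < r → 2 ∣ r →
    Σ (Fin (suc ℓ) → Poly) λ p →
    ((i : Fin (suc ℓ)) → NonZeroP (p i)) ×
    (sumFin (suc ℓ) (λ i → p i *P dDiv r ℓ (toℕ i)) ≈P rhs ℓ)
corollary4p5 r ℓ _ (divides s r≡s*2) =
  let p , p≢0 , ∑p≈Φ = ∃nonzero-cofactorSum≈pochhammer ℓ s
  in  p ∘ toℕ ,
      (λ i → p≢0 (toℕ i) (toℕ<n i)) ,
      cofactorSum≈pochhammer⇒sumFin≈rhs {r} {s} r≡s*2 ℓ p ∑p≈Φ
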